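{- Let $\mathcal{A}$ be an antimatroid that is not the power set of its elements. Then there is a set $S\notin\mathcal{A}$ such that $\mathcal{A}\cup\{S\}$ is also an antimatroid.
   Context: An antimatroid is a finite family $\mathcal{A}$ of finite sets that is closed under unions and accessible (for every nonempty $T\in\mathcal{A}$ there exists $x\in T$ with $T\setminus\{x\}\in\mathcal{A}$). Its elements are the members of $\bigcup\mathcal{A}$. -}

module Defs where

open import Data.Nat using (ℕ)
open import Data.List using (List; _∷_)
open import Data.Fin using (Fin)
open import Data.Fin.Subset as S using (Subset; _∪_; _-_; ⋃; Nonempty; _⊆_)
open import Data.List.Membership.Propositional using (_∈_; _∉_)
open import Data.Product using (∃; _×_)
open import Function.Bundles using (_⇔_)

-- A finite family of finite sets, all drawn from the ground type Fin n,
-- represented as a list (membership up to propositional equality;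
-- duplicates are irrelevant).
Family : ℕ → Set
Family n = List (Subset n)

-- closed under (pairwise, hence all nonempty finite) unions
UnionClosed : ∀ {n} → Family n → Set
UnionClosed 𝒜 = ∀ {X Y} → X ∈ 𝒜 → Y ∈ 𝒜 → (X ∪ Y) ∈ 𝒜

Accessible : ∀ {n} → Family n → Set
Accessible 𝒜 = ∀ {T} → T ∈ 𝒜 → Nonempty T →
  ∃ λ x → (x S.∈ T) × ((T - x) ∈ 𝒜)

IsAntimatroid : ∀ {n} → Family n → Set
IsAntimatroid 𝒜 = UnionClosed 𝒜 × Accessible 𝒜

Elements : ∀ {n} → Family n → Subset n
Elements 𝒜 = ⋃ 𝒜

IsPowerSetOfElements : ∀ {n} → Family n → Set
IsPowerSetOfElements 𝒜 = ∀ T → (T ∈ 𝒜) ⇔ (T ⊆ Elements 𝒜)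

insert : ∀ {n} → Subset n → Family n → Family n
insert S 𝒜 = S ∷ 𝒜

-- Call (A , x) a gap of 𝒜 if A ∈ 𝒜 but A ∪ {x} ∉ 𝒜.
--  * A nonempty accessible family contains ∅; if in addition it has no gap,
--    then every subset of the ground set is feasible, so 𝒜 is the power set
--    of its elements.  Hence (for 𝒜 ≠ ∅) the hypothesis yields a gap.
--  * Given a gap (A , x), put S = A ∪ {x}.  If S ∪ B ∈ 𝒜 ∪ {S} for every
--    B ∈ 𝒜, then 𝒜 ∪ {S} is union-closed, and S is accessible through
--    S - x = A, so S is the required set.  Otherwise some B ∈ 𝒜 has
--    S ∪ B ∉ 𝒜 ∪ {S}; then (A ∪ B , x) is again a gap and A ⊂ A ∪ B
--    strictly.  Since ⊃ is well founded on subsets, this search terminates.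
--  * The empty family is extended by S = ∅.
module Submission where

open import Defs
open import Data.Nat using (ℕ)
open import Data.Fin using (Fin) renaming (_≟_ to _≟ᶠ_)
import Data.Fin.Properties as FinProps
open import Data.Fin.Subset as S using (Subset; inside; outside; _∪_; _-_; _─_; ⁅_⁆; _⊆_; _⊂_; _⊃_; ⋃; Nonempty)
open import Data.Fin.Subset.Properties
open import Data.Fin.Subset.Induction using (⊂-wellFounded; ⊃-wellFounded)
open import Induction.WellFounded using (Acc; acc)
open import Data.List using ([]; _∷_)
open import Data.List.Membership.Propositional using (_∈_; _∉_)
open import Data.List.Relation.Unary.Any using (here; there)
open import Data.Vec using (_∷_; there)
import Data.List.Membership.DecPropositional as DecMembership
import Data.Vec.Properties as VecProps
import Data.Bool as Bool
open import Data.Product using (∃; _×_; _,_; proj₁)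
open import Data.Sum using (_⊎_; inj₁; inj₂)
open import Data.Empty using (⊥-elim)
open import Relation.Nullary using (¬_; Dec; yes; no; ¬?; _×-dec_)
open import Relation.Nullary.Decidable using (decidable-stable)
open import Relation.Unary using (Pred; Decidable)
open import Relation.Binary.PropositionalEquality using (_≡_; refl; sym; cong; subst; module ≡-Reasoning)
open import Function.Bundles using (mk⇔)

private
  variable
    n : ℕ

∪-least : ∀ {p q r : Subset n} → p ⊆ r → q ⊆ r → p ∪ q ⊆ r
∪-least {p = p} {q} p⊆r q⊆r y∈p∪q with x∈p∪q⁻ p q y∈p∪q
... | inj₁ y∈p = p⊆r y∈p
... | inj₂ y∈q = q⊆r y∈q

∪-absorb : ∀ {p q : Subset n} → q ⊆ p → p ∪ q ≡ p
∪-absorb {q = q} q⊆p = ⊆-antisym (∪-least ⊆-refl q⊆p) (p⊆p∪q q)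

⁅⁆⊆ : ∀ {x : Fin n} {p : Subset n} → x S.∈ p → ⁅ x ⁆ ⊆ p
⁅⁆⊆ {x = x} {p} x∈p y∈⁅x⁆ = subst (S._∈ p) (sym (x∈⁅y⁆⇒x≡y x y∈⁅x⁆)) x∈p

x∈p─q⇒x∉q : ∀ (p q : Subset n) {x} → x S.∈ p ─ q → x S.∉ q
x∈p─q⇒x∉q (_ ∷ p) (outside ∷ q) (there y∈) (there y∈q) = x∈p─q⇒x∉q p q y∈ y∈q
x∈p─q⇒x∉q (_ ∷ p) (inside ∷ q)  (there y∈) (there y∈q) = x∈p─q⇒x∉q p q y∈ y∈q

remove-add : ∀ (T : Subset n) {x} → x S.∈ T → (T - x) ∪ ⁅ x ⁆ ≡ T
remove-add T {x} x∈T = ⊆-antisym (∪-least (p─q⊆p T ⁅ x ⁆) (⁅⁆⊆ x∈T)) T⊆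
  where
  T⊆ : T ⊆ (T - x) ∪ ⁅ x ⁆
  T⊆ {y} y∈T with y ≟ᶠ x
  ... | yes refl = x∈p∪q⁺ (inj₂ (x∈⁅x⁆ x))
  ... | no y≢x = x∈p∪q⁺ (inj₁ (x∈p∧x≢y⇒x∈p-y y∈T y≢x))

add-remove : ∀ (A : Subset n) {x} → x S.∉ A → (A ∪ ⁅ x ⁆) - x ≡ A
add-remove A {x} x∉A = ⊆-antisym ⊆A A⊆
  where
  ⊆A : (A ∪ ⁅ x ⁆) - x ⊆ A
  ⊆A {y} y∈ with x∈p∪q⁻ A ⁅ x ⁆ (p─q⊆p (A ∪ ⁅ x ⁆) ⁅ x ⁆ y∈)
  ... | inj₁ y∈A = y∈A
  ... | inj₂ y∈⁅x⁆ = ⊥-elim (x∈p─q⇒x∉q (A ∪ ⁅ x ⁆) ⁅ x ⁆ y∈ y∈⁅x⁆)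
  A⊆ : A ⊆ (A ∪ ⁅ x ⁆) - x
  A⊆ {y} y∈A = x∈p∧x≢y⇒x∈p-y (p⊆p∪q ⁅ x ⁆ y∈A) (λ { refl → x∉A y∈A })

⊆-or-witness : ∀ (p q : Subset n) → q ⊆ p ⊎ ∃ λ y → y S.∈ q × y S.∉ p
⊆-or-witness p q with FinProps.any? (λ y → (y ∈? q) ×-dec ¬? (y ∈? p))
... | yes witness = inj₂ witness
... | no ¬witness =
  inj₁ λ {y} y∈q → decidable-stable (y ∈? p) (λ y∉p → ¬witness (y , y∈q , y∉p))

_∈𝒜?_ : ∀ (A : Subset n) (𝒜 : Family n) → Dec (A ∈ 𝒜)
_∈𝒜?_ = DecMembership._∈?_ (VecProps.≡-dec Bool._≟_)

everywhere-or-counterexample : ∀ {a p} {X : Set a} {P : Pred X p} → Decidable P →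
  ∀ xs → (∀ {x} → x ∈ xs → P x) ⊎ ∃ λ x → x ∈ xs × ¬ P x
everywhere-or-counterexample P? [] = inj₁ λ ()
everywhere-or-counterexample P? (x ∷ xs) with P? x | everywhere-or-counterexample P? xs
... | no ¬px | _ = inj₂ (x , here refl , ¬px)
... | yes _  | inj₂ (y , y∈xs , ¬py) = inj₂ (y , there y∈xs , ¬py)
... | yes px | inj₁ all = inj₁ λ { (here refl) → px ; (there y∈xs) → all y∈xs }

⊆⋃ : ∀ (𝒜 : Family n) {T} → T ∈ 𝒜 → T ⊆ ⋃ 𝒜
⊆⋃ (A ∷ 𝒜) (here refl) = p⊆p∪q (⋃ 𝒜)
⊆⋃ (A ∷ 𝒜) (there T∈𝒜) y∈T = q⊆p∪q A (⋃ 𝒜) (⊆⋃ 𝒜 T∈𝒜 y∈T)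

complete⇒powerSet : ∀ {𝒜 : Family n} → (∀ T → T ∈ 𝒜) → IsPowerSetOfElements 𝒜
complete⇒powerSet {𝒜 = 𝒜} all T = mk⇔ (⊆⋃ 𝒜) (λ _ → all T)

empty-feasible : ∀ {𝒜 : Family n} → Accessible 𝒜 → ∀ {T} → T ∈ 𝒜 → S.⊥ ∈ 𝒜
empty-feasible {𝒜 = 𝒜} acc𝒜 {T} = go T (⊂-wellFounded T)
  where
  go : ∀ T → Acc _⊂_ T → T ∈ 𝒜 → S.⊥ ∈ 𝒜
  go T (acc smaller) T∈𝒜 with nonempty? T
  ... | no empty = subst (_∈ 𝒜) (Empty-unique empty) T∈𝒜
  ... | yes ne with acc𝒜 T∈𝒜 ne
  ...   | x , x∈T , T-x∈𝒜 = go (T - x) (smaller (x∈p⇒p-x⊂p x∈T)) T-x∈𝒜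

SingletonClosed : Family n → Set
SingletonClosed 𝒜 = ∀ {A} → A ∈ 𝒜 → ∀ x → (A ∪ ⁅ x ⁆) ∈ 𝒜

Gap : Family n → Subset n → Fin n → Set
Gap 𝒜 A x = A ∈ 𝒜 × (A ∪ ⁅ x ⁆) ∉ 𝒜

singletonClosed-or-gap : ∀ (𝒜 : Family n) → SingletonClosed 𝒜 ⊎ ∃ λ A → ∃ λ x → Gap 𝒜 A x
singletonClosed-or-gap {n} 𝒜
  with everywhere-or-counterexample (λ A → FinProps.all? (λ x → (A ∪ ⁅ x ⁆) ∈𝒜? 𝒜)) 𝒜
... | inj₁ closed = inj₁ λ A∈𝒜 → closed A∈𝒜
... | inj₂ (A , A∈𝒜 , ¬closed) with FinProps.¬∀⟶∃¬ n _ (λ x → (A ∪ ⁅ x ⁆) ∈𝒜? 𝒜) ¬closed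
...   | x , A∪x∉𝒜 = inj₂ (A , x , A∈𝒜 , A∪x∉𝒜)

gapFree⇒complete : ∀ {𝒜 : Family n} → S.⊥ ∈ 𝒜 → SingletonClosed 𝒜 → ∀ T → T ∈ 𝒜
gapFree⇒complete {𝒜 = 𝒜} ∅∈𝒜 closed T = go T (⊂-wellFounded T)
  where
  go : ∀ T → Acc _⊂_ T → T ∈ 𝒜
  go T (acc smaller) with nonempty? T
  ... | no empty = subst (_∈ 𝒜) (sym (Empty-unique empty)) ∅∈𝒜
  ... | yes (x , x∈T) = subst (_∈ 𝒜) (remove-add T x∈T)
        (closed (go (T - x) (smaller (x∈p⇒p-x⊂p x∈T))) x)

Extendable : Family n → Set
Extendable {n} 𝒜 = ∃ λ (S : Subset n) → (S ∉ 𝒜) × IsAntimatroid (insert S 𝒜)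

JoinsCompatibly : Subset n → Family n → Set
JoinsCompatibly S 𝒜 = ∀ {B} → B ∈ 𝒜 → (S ∪ B) ∈ insert S 𝒜

insert-antimatroid : ∀ {𝒜 : Family n} {S} → IsAntimatroid 𝒜 → JoinsCompatibly S 𝒜 →
  (Nonempty S → ∃ λ x → x S.∈ S × (S - x) ∈ 𝒜) → IsAntimatroid (insert S 𝒜)
insert-antimatroid {𝒜 = 𝒜} {S} (union𝒜 , acc𝒜) joins accS = union , access
  where
  union : UnionClosed (insert S 𝒜)
  union (here refl) (here refl) = here (∪-idem S)
  union (here refl) (there Y∈𝒜) = joins Y∈𝒜
  union {X} (there X∈𝒜) (here refl) = subst (_∈ insert S 𝒜) (∪-comm S X) (joins X∈𝒜)
  union (there X∈𝒜) (there Y∈𝒜) = there (union𝒜 X∈𝒜 Y∈𝒜)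
  access : Accessible (insert S 𝒜)
  access (here refl) ne with accS ne
  ... | x , x∈S , S-x∈𝒜 = x , x∈S , there S-x∈𝒜
  access (there T∈𝒜) ne with acc𝒜 T∈𝒜 ne
  ... | x , x∈T , T-x∈𝒜 = x , x∈T , there T-x∈𝒜

closeGap : ∀ {𝒜 : Family n} {A x} → IsAntimatroid 𝒜 → Gap 𝒜 A x →
  JoinsCompatibly (A ∪ ⁅ x ⁆) 𝒜 → Extendable 𝒜
closeGap {A = A} {x} am (A∈𝒜 , A∪x∉𝒜) joins =
  A ∪ ⁅ x ⁆ , A∪x∉𝒜 ,
  insert-antimatroid am joins (λ _ → x , x∈p∪q⁺ (inj₂ (x∈⁅x⁆ x)) , A∪x-x∈𝒜)
  where
  x∉A : x S.∉ A
  x∉A x∈A = A∪x∉𝒜 (subst (_∈ _) (sym (∪-absorb (⁅⁆⊆ x∈A))) A∈𝒜)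
  A∪x-x∈𝒜 : ((A ∪ ⁅ x ⁆) - x) ∈ _
  A∪x-x∈𝒜 = subst (_∈ _) (sym (add-remove A x∉A)) A∈𝒜

enlargeGap : ∀ {𝒜 : Family n} {A B x} → UnionClosed 𝒜 → Gap 𝒜 A x → B ∈ 𝒜 →
  ((A ∪ ⁅ x ⁆) ∪ B) ∉ insert (A ∪ ⁅ x ⁆) 𝒜 → Gap 𝒜 (A ∪ B) x × A ⊂ A ∪ B
enlargeGap {𝒜 = 𝒜} {A} {B} {x} union𝒜 (A∈𝒜 , _) B∈𝒜 S∪B∉ =
  (union𝒜 A∈𝒜 B∈𝒜 , λ A∪B∪x∈𝒜 → S∪B∉ (there (subst (_∈ 𝒜) reassoc A∪B∪x∈𝒜))) , A⊂A∪B
  where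
  open ≡-Reasoning
  reassoc : (A ∪ B) ∪ ⁅ x ⁆ ≡ (A ∪ ⁅ x ⁆) ∪ B
  reassoc = begin
    (A ∪ B) ∪ ⁅ x ⁆   ≡⟨ ∪-assoc A B ⁅ x ⁆ ⟩
    A ∪ (B ∪ ⁅ x ⁆)   ≡⟨ cong (A ∪_) (∪-comm B ⁅ x ⁆) ⟩
    A ∪ (⁅ x ⁆ ∪ B)   ≡⟨ ∪-assoc A ⁅ x ⁆ B ⟨
    (A ∪ ⁅ x ⁆) ∪ B   ∎
  -- B ⊆ A ∪ {x} would make (A ∪ {x}) ∪ B = A ∪ {x}, which lies in 𝒜 ∪ {A ∪ {x}}.
  A⊂A∪B : A ⊂ A ∪ B
  A⊂A∪B with ⊆-or-witness (A ∪ ⁅ x ⁆) B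
  ... | inj₁ B⊆S = ⊥-elim (S∪B∉ (here (∪-absorb B⊆S)))
  ... | inj₂ (y , y∈B , y∉S) = p⊆p∪q B , y , q⊆p∪q A B y∈B , (λ y∈A → y∉S (p⊆p∪q ⁅ x ⁆ y∈A))

gap⇒extendable : ∀ {𝒜 : Family n} {A x} → IsAntimatroid 𝒜 → Gap 𝒜 A x → Extendable 𝒜
gap⇒extendable {𝒜 = 𝒜} {A} {x} am = go A (⊃-wellFounded A)
  where
  go : ∀ A → Acc _⊃_ A → Gap 𝒜 A x → Extendable 𝒜
  go A (acc larger) gap
    with everywhere-or-counterexample (λ B → ((A ∪ ⁅ x ⁆) ∪ B) ∈𝒜? insert (A ∪ ⁅ x ⁆) 𝒜) 𝒜
  ... | inj₁ joins = closeGap am gap joins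
  ... | inj₂ (B , B∈𝒜 , obstructs) with enlargeGap (proj₁ am) gap B∈𝒜 obstructs
  ...   | gap′ , A⊂A∪B = go (A ∪ B) (larger A⊂A∪B) gap′

lemma10 : ∀ (n : ℕ) (𝒜 : Family n) → IsAntimatroid 𝒜 → ¬ IsPowerSetOfElements 𝒜 →
    ∃ λ (S : Subset n) → (S ∉ 𝒜) × IsAntimatroid (insert S 𝒜)
lemma10 n [] _ _ =
  S.⊥ , (λ ()) , insert-antimatroid ((λ ()) , (λ ())) (λ ()) (λ (_ , y∈∅) → ⊥-elim (∉⊥ y∈∅))
lemma10 n 𝒜@(A₀ ∷ _) am@(_ , acc𝒜) notPowerSet with singletonClosed-or-gap 𝒜
... | inj₂ (A , x , gap) = gap⇒extendable am gap
... | inj₁ closed =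
  ⊥-elim (notPowerSet (complete⇒powerSet
    (gapFree⇒complete (empty-feasible acc𝒜 (here refl)) closed)))
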